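{- Let $k\geqslant1$ and let ${\tt w}_k=D^k({\tt f})$ be the word obtained from the Fibonacci word ${\tt f}$ by deleting the first $k$ occurrences of ${\tt a}$ and the first $k$ occurrences of ${\tt b}$. Then there exists $N=N(k)$ such that $r_{{\tt w}_k}(n)=n+k$ for all $n>N$.
   Context: The Fibonacci word ${\tt f}={\tt a}{\tt b}{\tt a}{\tt a}{\tt b}{\tt a}{\tt b}{\tt a}\cdots$ is the fixed point of $\varrho_F:{\tt a}\mapsto{\tt a}{\tt b},\ {\tt b}\mapsto{\tt a}$. $D$ deletes the first ${\tt a}$ and the first ${\tt b}$ of a word. Words are indexed from position $0$; $p_{\tt a}(n)$, $p_{\tt b}(n)$ denote the positions of the $n$-th ${\tt a}$ and $n$-th ${\tt b}$, and $r_{\tt w}(n)=p_{\tt b}(n)-p_{\tt a}(n)$. -}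

module Defs where

open import Data.Nat using (ℕ; zero; suc; _+_; _≤_; _<_)
open import Data.Bool using (Bool; true; false; not; _∧_)
open import Data.List using (List; []; _∷_; _++_; concatMap; length; filterᵇ; upTo)
open import Data.Product using (_×_)
open import Function using (_∘_)
open import Relation.Binary.PropositionalEquality using (_≡_)

data Letter : Set where
  a b : Letter

Word : Set
Word = ℕ → Letter

ρF : Letter → List Letter
ρF a = a ∷ b ∷ []
ρF b = a ∷ []

ρF* : List Letter → List Letter
ρF* = concatMap ρF

iter : ℕ → List Letter → List Letter
iter zero    u = u
iter (suc m) u = iter m (ρF* u)

-- lookup with a default (the default is never used below, see fib)
lookupD : List Letter → ℕ → Letter
lookupD []      _       = a
lookupD (x ∷ u) zero    = x
lookupD (x ∷ u) (suc i) = lookupD u i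

-- The Fibonacci word f, the fixed point of ρF starting with a.
-- ρF^(n+1)(a) is a prefix of f of length F_{n+3} ≥ n+1, so position n is
-- correctly read off from it.
fib : Word
fib n = lookupD (iter (suc n) (a ∷ [])) n

_==_ : Letter → Letter → Bool
a == a = true
b == b = true
_ == _ = false

count : Letter → Word → ℕ → ℕ
count c w zero    = 0
count c w (suc i) with w i == c
... | true  = suc (count c w i)
... | false = count c w i

-- position i of w survives D^k (deleting the first k a's and first k b's):
-- it is deleted iff its letter occurs fewer than k times before it.
keptᵇ : ℕ → Word → ℕ → Bool
keptᵇ k w i with count (w i) w i Data.Nat.<ᵇ k
  where import Data.Nat
... | true  = false
... | false = true

-- D^k(w): the word of surviving letters.  At most 2k positions are deleted,
-- so the j-th surviving position (from 0) lies in [0, j + 2k].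
Dk : ℕ → Word → Word
Dk k w j = w (lookupN (filterᵇ (keptᵇ k w) (upTo (suc (j + (k + k))))) j)
  where
  lookupN : List ℕ → ℕ → ℕ
  lookupN []      _       = 0
  lookupN (x ∷ u) zero    = x
  lookupN (x ∷ u) (suc i) = lookupN u i

IsNthPos : Word → Letter → ℕ → ℕ → Set
IsNthPos w c n p = (w p ≡ c) × (suc (count c w p) ≡ n)

{-# OPTIONS --safe #-}
-- Since f = ρF(f), the block ρF(f_j) starts in f at position j + |f_0 … f_(j-1)|_a.
-- Counting letters block by block, the (t+1)-th a of f, at position P, is the first
-- letter of the block of f_t, and the (t+1)-th b of f is the second letter of the
-- block ρF(f_P) = ab, which lies t+1 positions after P: r_f(n) = n.  D^k maps the (n+k)-th occurrence of each letter in f to its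
-- n-th occurrence in w_k, and once both letters have occurred k times every position
-- moves left by exactly 2k, so r_(w_k)(n) = r_f(n+k) = n+k.
module Submission where

open import Defs
open import Data.Nat using (ℕ; zero; suc; _+_; _∸_; _<_; _≤_; z≤n; s≤s; _≤′_; ≤′-refl; ≤′-step; _<ᵇ_)
open import Data.Nat.Properties
open import Algebra.Properties.CommutativeSemigroup +-commutativeSemigroup using (interchange; x∙yz≈y∙xz; xy∙z≈xz∙y)
open import Data.Bool using (true; false)
open import Data.List using (List; []; _∷_; _++_; length; filterᵇ; upTo)
open import Data.List.Properties using (concatMap-++; ++-assoc; ++-identityʳ; length-++; filter-++; upTo-∷ʳ)
open import Data.Product using (Σ; _×_; _,_; proj₁; proj₂; ∃-syntax)
open import Data.Sum using (_⊎_; inj₁; inj₂)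
open import Function using (_∘_)
open import Relation.Nullary using (contradiction)
open import Relation.Nullary.Decidable using (T?)
open import Relation.Nullary.Reflects using (Reflects; ofʸ; ofⁿ)
open import Relation.Binary.PropositionalEquality using (_≡_; refl; sym; trans; cong; cong₂; subst; module ≡-Reasoning)

open ≡-Reasoning

δ : Letter → Letter → ℕ
δ a a = 1
δ b b = 1
δ a b = 0
δ b a = 0

δ-cases : ∀ c x → (x ≡ c × δ c x ≡ 1) ⊎ δ c x ≡ 0
δ-cases a a = inj₁ (refl , refl)
δ-cases b b = inj₁ (refl , refl)
δ-cases a b = inj₂ refl
δ-cases b a = inj₂ refl

count-suc : ∀ c w i → count c w (suc i) ≡ δ c (w i) + count c w i
count-suc c w i with w i
count-suc a w i | a = refl
count-suc a w i | b = refl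
count-suc b w i | a = refl
count-suc b w i | b = refl

count-suc-at : ∀ c w i {x} → w i ≡ x → count c w (suc i) ≡ δ c x + count c w i
count-suc-at c w i wi = trans (count-suc c w i) (cong (λ x → δ c x + count c w i) wi)

count-a+b : ∀ w i → count a w i + count b w i ≡ i
count-a+b w zero    = refl
count-a+b w (suc i) = begin
  count a w (suc i) + count b w (suc i)
    ≡⟨ cong₂ _+_ (count-suc a w i) (count-suc b w i) ⟩
  (δ a (w i) + count a w i) + (δ b (w i) + count b w i)
    ≡⟨ interchange (δ a (w i)) (count a w i) (δ b (w i)) (count b w i) ⟩
  (δ a (w i) + δ b (w i)) + (count a w i + count b w i)
    ≡⟨ cong₂ _+_ (δa+δb (w i)) (count-a+b w i) ⟩
  suc i ∎
  where
  δa+δb : ∀ x → δ a x + δ b x ≡ 1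
  δa+δb a = refl
  δa+δb b = refl

count≤ : ∀ c w i → count c w i ≤ i
count≤ a w i = subst (count a w i ≤_) (count-a+b w i) (m≤m+n _ _)
count≤ b w i = subst (count b w i ≤_) (count-a+b w i) (m≤n+m _ _)

count-mono : ∀ c w {i j} → i ≤ j → count c w i ≤ count c w j
count-mono c w = go ∘ ≤⇒≤′
  where
  go : ∀ {i j} → i ≤′ j → count c w i ≤ count c w j
  go ≤′-refl            = ≤-refl
  go (≤′-step {n} i≤′n) = ≤-trans (go i≤′n) (subst (count c w n ≤_) (sym (count-suc c w n)) (m≤n+m _ _))

count-cong : ∀ c {w v : Word} n → (∀ i → i < n → w i ≡ v i) → count c w n ≡ count c v n
count-cong c         zero    _  = refl
count-cong c {w} {v} (suc n) eq = begin
  count c w (suc n)        ≡⟨ count-suc c w n ⟩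
  δ c (w n) + count c w n  ≡⟨ cong₂ _+_ (cong (δ c) (eq n ≤-refl)) (count-cong c n (λ i i<n → eq i (m≤n⇒m≤1+n i<n))) ⟩
  δ c (v n) + count c v n  ≡⟨ count-suc c v n ⟨
  count c v (suc n)        ∎

count-shift : ∀ c w j → count c w (suc j) ≡ δ c (w 0) + count c (w ∘ suc) j
count-shift c w zero    = count-suc c w 0
count-shift c w (suc j) = begin
  count c w (suc (suc j))                             ≡⟨ count-suc c w (suc j) ⟩
  δ c (w (suc j)) + count c w (suc j)                 ≡⟨ cong (δ c (w (suc j)) +_) (count-shift c w j) ⟩
  δ c (w (suc j)) + (δ c (w 0) + count c (w ∘ suc) j) ≡⟨ x∙yz≈y∙xz (δ c (w (suc j))) (δ c (w 0)) _ ⟩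
  δ c (w 0) + (δ c (w (suc j)) + count c (w ∘ suc) j) ≡⟨ cong (δ c (w 0) +_) (count-suc c (w ∘ suc) j) ⟨
  δ c (w 0) + count c (w ∘ suc) (suc j)               ∎

LetterAt : List Letter → ℕ → Letter → Set
LetterAt u i x = i < length u × lookupD u i ≡ x

LetterAt-++ˡ : ∀ u v {i x} → LetterAt u i x → LetterAt (u ++ v) i x
LetterAt-++ˡ (y ∷ u) v {zero}  (_       , eq) = s≤s z≤n , eq
LetterAt-++ˡ (y ∷ u) v {suc i} (s≤s i<u , eq) = let i<uv , eq′ = LetterAt-++ˡ u v (i<u , eq) in s≤s i<uv , eq′

LetterAt-++ʳ : ∀ u v {i x} → LetterAt v i x → LetterAt (u ++ v) (length u + i) x
LetterAt-++ʳ []      v h = h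
LetterAt-++ʳ (y ∷ u) v h = let i<uv , eq = LetterAt-++ʳ u v h in s≤s i<uv , eq

iter-ρF* : ∀ m u → iter m (ρF* u) ≡ ρF* (iter m u)
iter-ρF* zero    u = refl
iter-ρF* (suc m) u = iter-ρF* m (ρF* u)

fibPrefix : ℕ → List Letter
fibPrefix m = iter m (a ∷ [])

fibPrefix-suc : ∀ m → fibPrefix (suc m) ≡ ρF* (fibPrefix m)
fibPrefix-suc m = iter-ρF* m (a ∷ [])

fibPrefix-head : ∀ m → ∃[ u ] fibPrefix m ≡ a ∷ u
fibPrefix-head zero    = [] , refl
fibPrefix-head (suc m) = let u , eq = fibPrefix-head m in b ∷ ρF* u , trans (fibPrefix-suc m) (cong ρF* eq)

fibPrefix-extends : ∀ m → ∃[ r ] fibPrefix (suc m) ≡ fibPrefix m ++ r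
fibPrefix-extends zero    = b ∷ [] , refl
fibPrefix-extends (suc m) = let r , eq = fibPrefix-extends m in ρF* r , (begin
  fibPrefix (suc (suc m))       ≡⟨ fibPrefix-suc (suc m) ⟩
  ρF* (fibPrefix (suc m))       ≡⟨ cong ρF* eq ⟩
  ρF* (fibPrefix m ++ r)        ≡⟨ concatMap-++ ρF (fibPrefix m) r ⟩
  ρF* (fibPrefix m) ++ ρF* r    ≡⟨ cong (_++ ρF* r) (fibPrefix-suc m) ⟨
  fibPrefix (suc m) ++ ρF* r    ∎)

LetterAt-fibPrefix-mono : ∀ {m n i x} → m ≤ n → LetterAt (fibPrefix m) i x → LetterAt (fibPrefix n) i x
LetterAt-fibPrefix-mono = go ∘ ≤⇒≤′
  where
  go : ∀ {m n i x} → m ≤′ n → LetterAt (fibPrefix m) i x → LetterAt (fibPrefix n) i x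
  go ≤′-refl           h = h
  go (≤′-step {n} m≤n) h = let r , eq = fibPrefix-extends n in
    subst (λ u → LetterAt u _ _) (sym eq) (LetterAt-++ˡ (fibPrefix n) r (go m≤n h))

length-ρF* : ∀ u → length u ≤ length (ρF* u)
length-ρF* []      = z≤n
length-ρF* (a ∷ u) = m≤n⇒m≤1+n (s≤s (length-ρF* u))
length-ρF* (b ∷ u) = s≤s (length-ρF* u)

length-fibPrefix : ∀ m → m < length (fibPrefix m)
length-fibPrefix zero    = s≤s z≤n
length-fibPrefix (suc m) = let u , eq = fibPrefix-head m in
  subst (λ v → suc m < length v) (sym (trans (fibPrefix-suc m) (cong ρF* eq)))
    (s≤s (≤-trans (subst (λ v → m < length v) eq (length-fibPrefix m)) (s≤s (length-ρF* u))))

fib-LetterAt : ∀ m {i x} → LetterAt (fibPrefix m) i x → fib i ≡ x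
fib-LetterAt m {i} h with ≤-total m (suc i)
... | inj₁ m≤1+i = proj₂ (LetterAt-fibPrefix-mono m≤1+i h)
... | inj₂ 1+i≤m = trans (sym (proj₂ (LetterAt-fibPrefix-mono 1+i≤m fib-at-i))) (proj₂ h)
  where
  fib-at-i : LetterAt (fibPrefix (suc i)) i (fib i)
  fib-at-i = <-trans (n<1+n i) (length-fibPrefix (suc i)) , refl

-- The factor ρF (w j) of ρF(w) starts at position blockStart w j.
blockStart : Word → ℕ → ℕ
blockStart w j = j + count a w j

suc-+-δ : ∀ x j n → suc j + (δ a x + n) ≡ length (ρF x) + (j + n)
suc-+-δ a j n = cong suc (+-suc j n)
suc-+-δ b j n = refl

blockStart-suc : ∀ w j → blockStart w (suc j) ≡ length (ρF (w j)) + blockStart w j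
blockStart-suc w j = trans (cong (suc j +_) (count-suc a w j)) (suc-+-δ (w j) j (count a w j))

blockStart-cons : ∀ x u j → blockStart (lookupD (x ∷ u)) (suc j) ≡ length (ρF x) + blockStart (lookupD u) j
blockStart-cons x u j = trans (cong (suc j +_) (count-shift a (lookupD (x ∷ u)) j)) (suc-+-δ x j _)

ρF*-blockStart-a : ∀ u j → j < length u → LetterAt (ρF* u) (blockStart (lookupD u) j) a
ρF*-blockStart-a (a ∷ u) zero    _         = s≤s z≤n , refl
ρF*-blockStart-a (b ∷ u) zero    _         = s≤s z≤n , refl
ρF*-blockStart-a (x ∷ u) (suc j) (s≤s j<u) =
  subst (λ p → LetterAt (ρF* (x ∷ u)) p a) (sym (blockStart-cons x u j))
    (LetterAt-++ʳ (ρF x) (ρF* u) (ρF*-blockStart-a u j j<u))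

ρF*-blockStart-b : ∀ u j → LetterAt u j a → LetterAt (ρF* u) (suc (blockStart (lookupD u) j)) b
ρF*-blockStart-b (a ∷ u) zero    _               = s≤s (s≤s z≤n) , refl
ρF*-blockStart-b (x ∷ u) (suc j) (s≤s j<u , uj) =
  subst (λ p → LetterAt (ρF* (x ∷ u)) p b) (sym (trans (cong suc (blockStart-cons x u j)) (sym (+-suc (length (ρF x)) _))))
    (LetterAt-++ʳ (ρF x) (ρF* u) (ρF*-blockStart-b u j (j<u , uj)))

fib-ρF*-LetterAt : ∀ m {i x} → LetterAt (ρF* (fibPrefix m)) i x → fib i ≡ x
fib-ρF*-LetterAt m = fib-LetterAt (suc m) ∘ subst (λ u → LetterAt u _ _) (sym (fibPrefix-suc m))

j<length-fibPrefix : ∀ j → j < length (fibPrefix (suc j))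
j<length-fibPrefix j = <-trans (n<1+n j) (length-fibPrefix (suc j))

blockStart-fib : ∀ j → blockStart fib j ≡ blockStart (lookupD (fibPrefix (suc j))) j
blockStart-fib j = cong (j +_) (count-cong a j (λ i i<j → fib-LetterAt (suc j) (<-trans i<j (j<length-fibPrefix j) , refl)))

fib-blockStart-a : ∀ j → fib (blockStart fib j) ≡ a
fib-blockStart-a j = subst (λ p → fib p ≡ a) (sym (blockStart-fib j))
  (fib-ρF*-LetterAt (suc j) (ρF*-blockStart-a (fibPrefix (suc j)) j (j<length-fibPrefix j)))

fib-blockStart-b : ∀ j → fib j ≡ a → fib (suc (blockStart fib j)) ≡ b
fib-blockStart-b j fj = subst (λ p → fib (suc p) ≡ b) (sym (blockStart-fib j))
  (fib-ρF*-LetterAt (suc j) (ρF*-blockStart-b (fibPrefix (suc j)) j (j<length-fibPrefix j , fj)))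

count-fib-blockStart : ∀ j → count a fib (blockStart fib j) ≡ j × count b fib (blockStart fib j) ≡ count a fib j
count-fib-blockStart zero    = refl , refl
count-fib-blockStart (suc j) = step (fib j) refl (count-fib-blockStart j)
  where
  L = blockStart fib j

  block : ∀ {x} → fib j ≡ x → blockStart fib (suc j) ≡ length (ρF x) + L
  block fj = trans (blockStart-suc fib j) (cong (λ x → length (ρF x) + L) fj)

  step : ∀ x → fib j ≡ x → count a fib L ≡ j × count b fib L ≡ count a fib j →
         count a fib (blockStart fib (suc j)) ≡ suc j × count b fib (blockStart fib (suc j)) ≡ count a fib (suc j)
  step a fj (ca , cb) = trans (counts a) (cong suc ca) , trans (counts b) (trans (cong suc cb) (sym (count-suc-at a fib j fj)))
    where
    counts : ∀ c → count c fib (blockStart fib (suc j)) ≡ δ c b + (δ c a + count c fib L)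
    counts c = begin
      count c fib (blockStart fib (suc j))  ≡⟨ cong (count c fib) (block fj) ⟩
      count c fib (suc (suc L))             ≡⟨ count-suc-at c fib (suc L) (fib-blockStart-b j fj) ⟩
      δ c b + count c fib (suc L)           ≡⟨ cong (δ c b +_) (count-suc-at c fib L (fib-blockStart-a j)) ⟩
      δ c b + (δ c a + count c fib L)       ∎
  step b fj (ca , cb) = trans (counts a) (cong suc ca) , trans (counts b) (trans cb (sym (count-suc-at a fib j fj)))
    where
    counts : ∀ c → count c fib (blockStart fib (suc j)) ≡ δ c a + count c fib L
    counts c = begin
      count c fib (blockStart fib (suc j))  ≡⟨ cong (count c fib) (block fj) ⟩
      count c fib (suc L)                   ≡⟨ count-suc-at c fib L (fib-blockStart-a j) ⟩
      δ c a + count c fib L                 ∎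

fib-nth-a : ∀ t → IsNthPos fib a (suc t) (blockStart fib t)
fib-nth-a t = fib-blockStart-a t , cong suc (proj₁ (count-fib-blockStart t))

fib-nth-b : ∀ t → IsNthPos fib b (suc t) (blockStart fib t + suc t)
fib-nth-b t = subst (λ q → IsNthPos fib b (suc t) q) Q≡P+1+t
  (fib-blockStart-b P (fib-blockStart-a t) , cong suc (begin
    count b fib (suc (blockStart fib P))  ≡⟨ count-suc-at b fib (blockStart fib P) (fib-blockStart-a P) ⟩
    count b fib (blockStart fib P)        ≡⟨ proj₂ (count-fib-blockStart P) ⟩
    count a fib P                         ≡⟨ proj₁ (count-fib-blockStart t) ⟩
    t                                     ∎))
  where
  P = blockStart fib t
  Q≡P+1+t : suc (blockStart fib P) ≡ P + suc t
  Q≡P+1+t = trans (cong (λ n → suc (P + n)) (proj₁ (count-fib-blockStart t))) (sym (+-suc P t))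

lookupOr0 : List ℕ → ℕ → ℕ
lookupOr0 []       _       = 0
lookupOr0 (x ∷ xs) zero    = x
lookupOr0 (x ∷ xs) (suc i) = lookupOr0 xs i

lookupOr0-unique : (F : List ℕ → ℕ → ℕ) → (∀ i → F [] i ≡ 0) → (∀ x xs → F (x ∷ xs) zero ≡ x) →
                   (∀ x xs i → F (x ∷ xs) (suc i) ≡ F xs i) → ∀ xs i → F xs i ≡ lookupOr0 xs i
lookupOr0-unique F nil here there []       i       = nil i
lookupOr0-unique F nil here there (x ∷ xs) zero    = here x xs
lookupOr0-unique F nil here there (x ∷ xs) (suc i) = trans (there x xs i) (lookupOr0-unique F nil here there xs i)

lookupOr0-++ : ∀ ys x zs → lookupOr0 (ys ++ x ∷ zs) (length ys) ≡ x
lookupOr0-++ []       x zs = refl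
lookupOr0-++ (y ∷ ys) x zs = lookupOr0-++ ys x zs

-- Dk reads its list of surviving positions with a lookup function local to Defs.
-- Once the index is generalised away from that function's parameter, unification
-- names it as `lookupDk k w j`, and its defining equations identify it with lookupOr0.
mutual
  private
    lookupDk : ℕ → Word → ℕ → List ℕ → ℕ → ℕ
    lookupDk = _

  Dk-unfold : ∀ k w j → Dk k w j ≡ w (lookupOr0 (filterᵇ (keptᵇ k w) (upTo (suc (j + (k + k))))) j)
  Dk-unfold k w zero with filterᵇ (keptᵇ k w) (upTo (suc (k + k)))
  ... | []    = refl
  ... | _ ∷ _ = refl
  Dk-unfold k w (suc i) with filterᵇ (keptᵇ k w) (upTo (suc (suc i + (k + k))))
  ... | []     = refl
  ... | _ ∷ xs with suc i
  ...   | j = cong w (lookupOr0-unique (lookupDk k w j) (λ _ → refl) (λ _ _ → refl) (λ _ _ _ → refl) xs i)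

upTo-extends : ∀ {m n} → m ≤ n → ∃[ r ] upTo n ≡ upTo m ++ r
upTo-extends = go ∘ ≤⇒≤′
  where
  go : ∀ {m n} → m ≤′ n → ∃[ r ] upTo n ≡ upTo m ++ r
  go {m} ≤′-refl           = [] , sym (++-identityʳ (upTo m))
  go {m} (≤′-step {n} m≤n) = let r , eq = go m≤n in r ++ n ∷ [] , (begin
    upTo (suc n)            ≡⟨ upTo-∷ʳ n ⟨
    upTo n ++ n ∷ []        ≡⟨ cong (_++ n ∷ []) eq ⟩
    (upTo m ++ r) ++ n ∷ [] ≡⟨ ++-assoc (upTo m) r (n ∷ []) ⟩
    upTo m ++ r ++ n ∷ []   ∎)

module _ (k : ℕ) (w : Word) where

  keptᵇ-reflects : ∀ i → Reflects (k ≤ count (w i) w i) (keptᵇ k w i)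
  keptᵇ-reflects i with count (w i) w i <ᵇ k | <ᵇ-reflects-< (count (w i) w i) k
  ... | true  | ofʸ C<k = ofⁿ (<⇒≱ C<k)
  ... | false | ofⁿ C≮k = ofʸ (≮⇒≥ C≮k)

  keptᵇ-true : ∀ i → k ≤ count (w i) w i → keptᵇ k w i ≡ true
  keptᵇ-true i k≤C with keptᵇ k w i | keptᵇ-reflects i
  ... | true  | _       = refl
  ... | false | ofⁿ k≰C = contradiction k≤C k≰C

  keptUpTo : ℕ → List ℕ
  keptUpTo i = filterᵇ (keptᵇ k w) (upTo i)

  rank : ℕ → ℕ
  rank i = length (keptUpTo i)

  keptUpTo-extends : ∀ {m n} → m ≤ n → ∃[ r ] keptUpTo n ≡ keptUpTo m ++ r
  keptUpTo-extends {m} m≤n = let r , eq = upTo-extends m≤n in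
    filterᵇ (keptᵇ k w) r , trans (cong (filterᵇ (keptᵇ k w)) eq) (filter-++ (T? ∘ keptᵇ k w) (upTo m) r)

  keptUpTo-suc : ∀ i → keptUpTo (suc i) ≡ keptUpTo i ++ filterᵇ (keptᵇ k w) (i ∷ [])
  keptUpTo-suc i = trans (cong (filterᵇ (keptᵇ k w)) (sym (upTo-∷ʳ i))) (filter-++ (T? ∘ keptᵇ k w) (upTo i) (i ∷ []))

  keptUpTo-suc-kept : ∀ i → keptᵇ k w i ≡ true → keptUpTo (suc i) ≡ keptUpTo i ++ i ∷ []
  keptUpTo-suc-kept i kept with keptUpTo-suc i
  ... | eq rewrite kept = eq

  keptUpTo-suc-deleted : ∀ i → keptᵇ k w i ≡ false → keptUpTo (suc i) ≡ keptUpTo i ++ []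
  keptUpTo-suc-deleted i deleted with keptUpTo-suc i
  ... | eq rewrite deleted = eq

  rank-suc-kept : ∀ i → keptᵇ k w i ≡ true → rank (suc i) ≡ suc (rank i)
  rank-suc-kept i kept = trans (cong length (keptUpTo-suc-kept i kept)) (trans (length-++ (keptUpTo i)) (+-comm (rank i) 1))

  rank-suc-deleted : ∀ i → keptᵇ k w i ≡ false → rank (suc i) ≡ rank i
  rank-suc-deleted i deleted = cong length (trans (keptUpTo-suc-deleted i deleted) (++-identityʳ (keptUpTo i)))

  Dk-rank : ∀ i → keptᵇ k w i ≡ true → i ≤ rank i + (k + k) → Dk k w (rank i) ≡ w i
  Dk-rank i kept i≤r+2k = let r , eq = keptUpTo-extends (s≤s i≤r+2k) in begin
    Dk k w (rank i)                                       ≡⟨ Dk-unfold k w (rank i) ⟩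
    w (lookupOr0 (keptUpTo (suc (rank i + (k + k)))) (rank i)) ≡⟨ cong (λ xs → w (lookupOr0 xs (rank i))) eq ⟩
    w (lookupOr0 (keptUpTo (suc i) ++ r) (rank i))        ≡⟨ cong (λ xs → w (lookupOr0 (xs ++ r) (rank i))) (keptUpTo-suc-kept i kept) ⟩
    w (lookupOr0 ((keptUpTo i ++ i ∷ []) ++ r) (rank i))  ≡⟨ cong (λ xs → w (lookupOr0 xs (rank i))) (++-assoc (keptUpTo i) (i ∷ []) r) ⟩
    w (lookupOr0 (keptUpTo i ++ i ∷ r) (rank i))          ≡⟨ cong w (lookupOr0-++ (keptUpTo i) i r) ⟩
    w i                                                   ∎

  rank-from-counts : ∀ i → (∀ c → count c (Dk k w) (rank i) ≡ count c w i ∸ k) →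
                     (k + (count a w i ∸ k)) + (k + (count b w i ∸ k)) ≡ rank i + (k + k)
  rank-from-counts i counts = begin
    (k + (count a w i ∸ k)) + (k + (count b w i ∸ k))         ≡⟨ interchange k _ k _ ⟩
    (k + k) + ((count a w i ∸ k) + (count b w i ∸ k))         ≡⟨ cong ((k + k) +_) (sym (cong₂ _+_ (counts a) (counts b))) ⟩
    (k + k) + (count a (Dk k w) (rank i) + count b (Dk k w) (rank i)) ≡⟨ cong ((k + k) +_) (count-a+b (Dk k w) (rank i)) ⟩
    (k + k) + rank i                                          ≡⟨ +-comm (k + k) (rank i) ⟩
    rank i + (k + k)                                          ∎

  rank-bound : ∀ i → (∀ c → count c (Dk k w) (rank i) ≡ count c w i ∸ k) → i ≤ rank i + (k + k)
  rank-bound i counts = subst (_≤ rank i + (k + k)) (count-a+b w i)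
    (≤-trans (+-mono-≤ (m≤n+m∸n (count a w i) k) (m≤n+m∸n (count b w i) k)) (≤-reflexive (rank-from-counts i counts)))

  count-Dk-rank : ∀ c i → count c (Dk k w) (rank i) ≡ count c w i ∸ k
  count-Dk-rank c zero    = sym (0∸n≡0 k)
  count-Dk-rank c (suc i) with keptᵇ k w i in kept | keptᵇ-reflects i
  ... | true  | ofʸ k≤C = begin
    count c (Dk k w) (rank (suc i))        ≡⟨ cong (count c (Dk k w)) (rank-suc-kept i kept) ⟩
    count c (Dk k w) (suc (rank i))        ≡⟨ count-suc-at c (Dk k w) (rank i) (Dk-rank i kept (rank-bound i IH)) ⟩
    δ c (w i) + count c (Dk k w) (rank i)  ≡⟨ cong (δ c (w i) +_) (IH c) ⟩
    δ c (w i) + (count c w i ∸ k)          ≡⟨ kept-step (δ-cases c (w i)) ⟩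
    (δ c (w i) + count c w i) ∸ k          ≡⟨ cong (_∸ k) (count-suc c w i) ⟨
    count c w (suc i) ∸ k                  ∎
    where
    IH : ∀ c → count c (Dk k w) (rank i) ≡ count c w i ∸ k
    IH c = count-Dk-rank c i
    kept-step : (w i ≡ c × δ c (w i) ≡ 1) ⊎ δ c (w i) ≡ 0 →
                δ c (w i) + (count c w i ∸ k) ≡ (δ c (w i) + count c w i) ∸ k
    kept-step (inj₁ (wi≡c , _)) = sym (+-∸-assoc (δ c (w i)) (subst (λ x → k ≤ count x w i) wi≡c k≤C))
    kept-step (inj₂ δ≡0)        = trans (cong (_+ (count c w i ∸ k)) δ≡0) (cong (λ d → (d + count c w i) ∸ k) (sym δ≡0))
  ... | false | ofⁿ k≰C = begin
    count c (Dk k w) (rank (suc i))        ≡⟨ cong (count c (Dk k w)) (rank-suc-deleted i kept) ⟩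
    count c (Dk k w) (rank i)              ≡⟨ count-Dk-rank c i ⟩
    count c w i ∸ k                        ≡⟨ deleted-step (δ-cases c (w i)) ⟩
    (δ c (w i) + count c w i) ∸ k          ≡⟨ cong (_∸ k) (count-suc c w i) ⟨
    count c w (suc i) ∸ k                  ∎
    where
    deleted-step : (w i ≡ c × δ c (w i) ≡ 1) ⊎ δ c (w i) ≡ 0 → count c w i ∸ k ≡ (δ c (w i) + count c w i) ∸ k
    deleted-step (inj₁ (wi≡c , δ≡1)) = let C<k = subst (λ x → count x w i < k) wi≡c (≰⇒> k≰C) in
      trans (m≤n⇒m∸n≡0 (<⇒≤ C<k)) (sym (trans (cong (λ d → (d + count c w i) ∸ k) δ≡1) (m≤n⇒m∸n≡0 C<k)))
    deleted-step (inj₂ δ≡0)          = cong (λ d → (d + count c w i) ∸ k) (sym δ≡0)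

  rank-past-deletions : ∀ i → k ≤ count a w i → k ≤ count b w i → rank i + (k + k) ≡ i
  rank-past-deletions i k≤A k≤B = begin
    rank i + (k + k)                                   ≡⟨ rank-from-counts i (λ c → count-Dk-rank c i) ⟨
    (k + (count a w i ∸ k)) + (k + (count b w i ∸ k))  ≡⟨ cong₂ _+_ (m+[n∸m]≡n k≤A) (m+[n∸m]≡n k≤B) ⟩
    count a w i + count b w i                          ≡⟨ count-a+b w i ⟩
    i                                                  ∎

  rank-+ : ∀ i d → k ≤ count a w i → k ≤ count b w i → rank (i + d) ≡ rank i + d
  rank-+ i d k≤A k≤B = +-cancelʳ-≡ (k + k) _ _ (begin
    rank (i + d) + (k + k)   ≡⟨ rank-past-deletions (i + d) (past a k≤A) (past b k≤B) ⟩
    i + d                    ≡⟨ cong (_+ d) (rank-past-deletions i k≤A k≤B) ⟨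
    rank i + (k + k) + d     ≡⟨ xy∙z≈xz∙y (rank i) (k + k) d ⟩
    rank i + d + (k + k)     ∎)
    where
    past : ∀ c → k ≤ count c w i → k ≤ count c w (i + d)
    past c k≤ = ≤-trans k≤ (count-mono c w (m≤m+n i d))

  nthPos-Dk : ∀ c n i → IsNthPos w c (suc n + k) i → IsNthPos (Dk k w) c (suc n) (rank i)
  nthPos-Dk c n i (wi≡c , 1+C≡1+n+k) =
    trans (Dk-rank i kept (rank-bound i (λ c′ → count-Dk-rank c′ i))) wi≡c ,
    cong suc (trans (count-Dk-rank c i) (trans (cong (_∸ k) C≡n+k) (m+n∸n≡m n k)))
    where
    C≡n+k : count c w i ≡ n + k
    C≡n+k = suc-injective 1+C≡1+n+k
    kept : keptᵇ k w i ≡ true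
    kept = keptᵇ-true i (subst (λ x → k ≤ count x w i) (sym wi≡c) (subst (k ≤_) (sym C≡n+k) (m≤n+m k n)))

k≤count-a-fib : ∀ k i → k + k ≤ i → k ≤ count a fib i
k≤count-a-fib k i 2k≤i = subst (_≤ count a fib i) (proj₁ (count-fib-blockStart k))
  (count-mono a fib (≤-trans (+-monoʳ-≤ k (count≤ a fib k)) 2k≤i))

-- N = k: for n > k both letters occur at least k times before the (n+k)-th a of f,
-- so nothing after it is deleted.
theorem4p8 : (k : ℕ) → 1 ≤ k →
    Σ ℕ (λ N → (n : ℕ) → N < n →
      Σ ℕ (λ pa → Σ ℕ (λ pb →
        IsNthPos (Dk k fib) a n pa × IsNthPos (Dk k fib) b n pb
          × pb ≡ pa + (n + k))))
theorem4p8 k _ = k , λ where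
  (suc m) (s≤s k≤m) →
    let t = m + k
        P = blockStart fib t
        k≤A = subst (k ≤_) (sym (proj₁ (count-fib-blockStart t))) (m≤n+m k m)
        k≤B = subst (k ≤_) (sym (proj₂ (count-fib-blockStart t))) (k≤count-a-fib k t (+-monoˡ-≤ k k≤m))
    in rank k fib P , rank k fib (P + suc t) ,
       nthPos-Dk k fib a m P (fib-nth-a t) ,
       nthPos-Dk k fib b m (P + suc t) (fib-nth-b t) ,
       rank-+ k fib P (suc t) k≤A k≤B
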